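{- Let $k\ge1$, $(\alpha_1,\dots,\alpha_k)\in(\mathbb{N}^*)^k$, and $\beta_1<\dots<\beta_k$ positive integers. Let $\beta=(0,\beta_1,\dots,\beta_1,\dots,\beta_k,\dots,\beta_k)$ (with $\beta_j$ repeated $\alpha_j$ times), write $\beta=(0,\gamma_1,\dots,\gamma_\kappa)$ with $\kappa=\alpha_1+\dots+\alpha_k$, let $L_\beta=\{(0,\gamma_{\sigma(1)},\dots,\gamma_{\sigma(\kappa)}):\sigma\in\mathfrak{S}_\kappa\}$ (a set of distinct extended compositions), and let $u=\sum_{\omega\in L_\beta}\mu_\omega\,\omega\in\mathcal{C}_e$ with $\mu_\omega\in\mathbb{K}$. Put $\beta_0=0$. If $u$ is primitive in $\mathcal{C}_e$ and there exists $i\in\{1,\dots,k\}$ with $\beta_i\ge\beta_{i-1}+2$, then $u=0$.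
   Context: $\mathbb{K}$ is a field of characteristic $0$. $\mathcal{C}_e$ is the Hopf algebra with basis the extended compositions $(\alpha_0,\alpha_1,\dots,\alpha_p)$ ($\alpha_0\ge0$, $\alpha_i\ge1$ for $i\ge1$), product $(\alpha_0,\dots,\alpha_s)\ast(\beta_0,\dots,\beta_k)=(\alpha_0+\beta_0,\alpha_1,\dots,\alpha_s,\beta_1,\dots,\beta_k)$ and coproduct $\Delta((\alpha_0,\dots,\alpha_p))=\sum_{a=0}^{\alpha_0}\sum_{n=0}^{p}\sum_{1\le i_1<\dots<i_n\le p}\sum_{1\le k_{i_j}\le\alpha_{i_j}}\binom{\alpha_0}{a}\prod_j\binom{\alpha_{i_j}}{k_{i_j}}(a,k_{i_1},\dots,k_{i_n})\otimes(\alpha_0-a+\sum_j(\alpha_{i_j}-k_{i_j}),\alpha_{u_1},\dots,\alpha_{u_{p-n}})$, with $\{u_1<\dots<u_{p-n}\}$ the complement of $\{i_1,\dots,i_n\}$ in $\{1,\dots,p\}$. Primitive means $\Delta(u)=u\otimes(0)+(0)\otimes u$, $(0)$ being the unit. -}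

module Defs where

open import Level using (Level; _⊔_)
open import Algebra.Bundles using (CommutativeRing)
open import Data.Nat as ℕ using (ℕ; zero; suc; _∸_; _≤_; _≥_; _<_)
open import Data.Nat.Combinatorics using (_C_)
open import Data.Fin as Fin using (Fin; inject₁)
open import Data.List using (List; []; _∷_; [_]; map; concat; concatMap; replicate; deduplicate; upTo; foldr; _++_)
open import Data.List.Properties using (≡-dec)
open import Data.Product using (_×_; _,_; ∃; Σ)
open import Relation.Nullary using (¬_; yes; no)
open import Relation.Binary.PropositionalEquality using (_≡_)

record Field (c ℓ : Level) : Set (Level.suc (c ⊔ ℓ)) where
  field
    commutativeRing : CommutativeRing c ℓ
  open CommutativeRing commutativeRing public
  field
    1≉0     : ¬ (1# ≈ 0#)
    inverse : ∀ x → ¬ (x ≈ 0#) → ∃ λ y → (x * y) ≈ 1#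

module _ {c ℓ} (K : Field c ℓ) where
  open Field K

  ι : ℕ → Carrier
  ι zero    = 0#
  ι (suc n) = 1# + ι n

  CharZero : Set ℓ
  CharZero = ∀ n → ¬ (ι (suc n) ≈ 0#)

-- Extended compositions (α₀, α₁, …, α_p) are represented as lists
-- α₀ ∷ α₁ ∷ … ∷ α_p ∷ [] of naturals.

Comp : Set
Comp = List ℕ

_≟c_ : (x y : Comp) → Relation.Nullary.Dec (x ≡ y)
_≟c_ = ≡-dec ℕ._≟_

unitC : Comp
unitC = 0 ∷ []

oneTo : ℕ → List ℕ
oneTo n = map suc (upTo n)

zeroTo : ℕ → List ℕ
zeroTo n = upTo (suc n)

-- A term (c , L , e , R) means:
-- coefficient c (product of binomials ∏ C(α_{i_j}, k_{i_j})),
-- chosen parts L = (k_{i_1},…,k_{i_n}), leftover mass e = Σ (α_{i_j} - k_{i_j}),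
-- unchosen parts R = (α_{u_1},…,α_{u_{p-n}}).
ΔTail : List ℕ → List (ℕ × List ℕ × ℕ × List ℕ)
ΔTail [] = (1 , [] , 0 , []) ∷ []
ΔTail (x ∷ xs) = concatMap step (ΔTail xs)
  where
  step : ℕ × List ℕ × ℕ × List ℕ → List (ℕ × List ℕ × ℕ × List ℕ)
  step (c , L , e , R) =
    (c , L , e , x ∷ R) ∷
    map (λ k → ((x C k) ℕ.* c , k ∷ L , (x ∸ k) ℕ.+ e , R)) (oneTo x)

-- Δ(α₀,…,α_p) as a list of terms (coefficient , left ⊗ right)
ΔTerms : Comp → List (ℕ × Comp × Comp)
ΔTerms [] = []
ΔTerms (a₀ ∷ xs) =
  concatMap (λ a → map (λ { (c , L , e , R) →
                             ((a₀ C a) ℕ.* c , a ∷ L , ((a₀ ∸ a) ℕ.+ e) ∷ R) })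
                       (ΔTail xs))
            (zeroTo a₀)

-- Elements of C_e over K, as formal finite linear combinations,
-- together with their coefficient functions.

module LinComb {c ℓ} (K : Field c ℓ) where
  open Field K

  Elem : Set c
  Elem = List (Carrier × Comp)

  δ : Comp → Comp → Carrier
  δ x y with x ≟c y
  ... | yes _ = 1#
  ... | no  _ = 0#

  coeff : Elem → Comp → Carrier
  coeff u ω = foldr (λ { (m , ω') acc → m * δ ω' ω + acc }) 0# u

  ΔcoeffBasis : Comp → Comp → Comp → Carrier
  ΔcoeffBasis ω ω₁ ω₂ =
    foldr (λ { (n , l , r) acc → ι K n * δ l ω₁ * δ r ω₂ + acc }) 0# (ΔTerms ω)

  Δcoeff : Elem → Comp → Comp → Carrier
  Δcoeff u ω₁ ω₂ = foldr (λ { (m , ω) acc → m * ΔcoeffBasis ω ω₁ ω₂ + acc }) 0# u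

  -- u is primitive: Δ(u) = u ⊗ (0) + (0) ⊗ u, compared coefficientwise
  -- on the basis {ω₁ ⊗ ω₂} of C_e ⊗ C_e.
  Primitive : Elem → Set ℓ
  Primitive u = ∀ ω₁ ω₂ →
    Δcoeff u ω₁ ω₂ ≈ (coeff u ω₁ * δ ω₂ unitC + δ ω₁ unitC * coeff u ω₂)

  IsZero : Elem → Set ℓ
  IsZero u = ∀ ω → coeff u ω ≈ 0#

-- Permutations of a list (all orderings, with repetitions if the list
-- has repeated entries).

insertions : ℕ → List ℕ → List (List ℕ)
insertions x [] = (x ∷ []) ∷ []
insertions x (y ∷ ys) = (x ∷ y ∷ ys) ∷ map (y ∷_) (insertions x ys)

permutations : List ℕ → List (List ℕ)
permutations [] = [] ∷ []
permutations (x ∷ xs) = concatMap (insertions x) (permutations xs)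

gammaList : ∀ {k} → (Fin k → ℕ) → (Fin k → ℕ) → List ℕ
gammaList {zero}  α β = []
gammaList {suc k} α β = replicate (α Fin.zero) (β Fin.zero) ++ gammaList (λ i → α (Fin.suc i)) (λ i → β (Fin.suc i))

Lβ : ∀ {k} → (Fin k → ℕ) → (Fin k → ℕ) → List Comp
Lβ α β = deduplicate _≟c_ (map (0 ∷_) (permutations (gammaList α β)))

-- β_{i-1} with the convention β_0 = 0 (indices of Fin k are shifted by one)
prevβ : ∀ {k} → (Fin k → ℕ) → Fin k → ℕ
prevβ β Fin.zero = 0
prevβ β (Fin.suc i) = β (inject₁ i)

-- Primitivity of u makes its coproduct vanish at every ω₁ ⊗ ω₂ with ω₁, ω₂ ≠ (0).  The gap gives
-- v = β_i − 1 ≥ 1 with v ∉ {β_j}.  For ω = (0, …, v+1, …) ∈ L_β take ω₁ ⊗ ω₂ = (0, …, v, …) ⊗ (1): in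
-- Δ(ω) it is the term choosing every part and lowering that v+1 by one, with positive coefficient; in
-- Δ(ω′) for ω′ ∈ L_β it can only arise the same way, and since ω′ has no part v the lowered part
-- is that v+1 and all others are kept, so ω′ = ω.  Hence Δ(u) has coefficient μ_ω · n there with
-- n a positive integer, and in characteristic zero μ_ω = 0.

module Submission where

open import Defs
open import Data.Nat using (ℕ; zero; suc; _≤_; _<_; _+_; _*_; _∸_; z≤n; s≤s; s≤s⁻¹)
open import Data.Nat.Properties
  using (≤-refl; ≤-trans; ≤-reflexive; <⇒≤; <⇒≢; >⇒≢; 1+n≢n; 1+n≰n; +-suc;
         +-monoˡ-≤; *-mono-≤; m≤m+n; m≤n+m; m+n≤o⇒n≤o; m+n≤o⇒m≤o∸n; m+n∸m≡n; m+[n∸m]≡n)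
import Data.Nat.Properties as ℕ
open import Data.Nat.Combinatorics using (_C_; nCk+nC[k+1]≡[n+1]C[k+1])
open import Data.Nat.ListAction using (sum)
open import Data.Fin using (Fin)
open import Data.Fin as Fin using ()
open import Data.Fin.Properties using (<-cmp; toℕ-inject₁)
open import Data.List using (List; []; _∷_; _++_; map; foldr; replicate)
open import Data.List.Properties using (++-identityʳ; ++-conicalʳ; ∷-injectiveʳ)
open import Data.List.Membership.Propositional using (_∈_; _∉_; find; lose)
open import Data.List.Membership.Propositional.Properties
  using (∈-map⁺; ∈-map⁻; ∈-upTo⁺; ∈-upTo⁻; ∈-++⁺ˡ; ∈-++⁺ʳ; ∈-++⁻; ∈-concatMap⁺; ∈-concatMap⁻; ∈-∃++)
open import Data.List.Relation.Unary.Any using (here; there)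
open import Data.List.Relation.Unary.Any.Properties using (deduplicate⁻)
open import Data.List.Relation.Unary.All using (All; []; _∷_; lookup; tabulate)
open import Data.List.Relation.Unary.All.Properties using (++⁻)
open import Data.List.Relation.Unary.AllPairs using (_∷_)
open import Data.List.Relation.Unary.Unique.Propositional using (Unique)
open import Data.List.Relation.Unary.Unique.DecPropositional.Properties using (deduplicate-!)
open import Data.List.Relation.Binary.Permutation.Propositional using (_↭_; ↭-refl; ↭-trans; ↭-sym; prep; swap)
open import Data.List.Relation.Binary.Permutation.Propositional.Properties using (∈-resp-↭)
open import Data.Product using (_×_; _,_; ∃)
open import Data.Sum using (inj₁; inj₂)
open import Data.Empty using (⊥-elim)
open import Function using (_∘_)
open import Relation.Binary.Definitions using (tri<; tri≈; tri>)
open import Relation.Binary.PropositionalEquality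
  using (_≡_; _≢_; refl; sym; trans; cong; cong₂; subst)
open import Relation.Nullary using (¬_; yes; no)

k≤n⇒nCk>0 : ∀ {n k} → k ≤ n → 0 < n C k
k≤n⇒nCk>0 {k = zero}  _         = s≤s z≤n
k≤n⇒nCk>0 {suc n} {suc k} (s≤s k≤n) =
  subst (0 <_) (nCk+nC[k+1]≡[n+1]C[k+1] n k) (≤-trans (k≤n⇒nCk>0 k≤n) (m≤m+n _ _))

-- The terms (c , ks , e , []) of ΔTail xs, in which every part is chosen: each part x of xs
-- becomes k = x − d ≥ 1, and e is the sum of the drops d.
data Lowering : List ℕ → List ℕ → ℕ → Set where
  []    : Lowering [] [] 0
  lower : ∀ {x k d xs ks e} → 1 ≤ k → k + d ≡ x → Lowering xs ks e → Lowering (x ∷ xs) (k ∷ ks) (d + e)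

lowering-refl : ∀ {xs} → All (1 ≤_) xs → Lowering xs xs 0
lowering-refl []             = []
lowering-refl (1≤x ∷ 1≤xs) = lower 1≤x (ℕ.+-identityʳ _) (lowering-refl 1≤xs)

lowering-by-zero⇒≡ : ∀ {xs ks e} → Lowering xs ks e → e ≡ 0 → xs ≡ ks
lowering-by-zero⇒≡ []                             _  = refl
lowering-by-zero⇒≡ (lower {d = zero} _ refl low) e≡0 = cong₂ _∷_ (ℕ.+-identityʳ _) (lowering-by-zero⇒≡ low e≡0)

lowering-by-one : ∀ {v} pre post → All (1 ≤_) pre → 1 ≤ v → All (1 ≤_) post →
  Lowering (pre ++ suc v ∷ post) (pre ++ v ∷ post) 1
lowering-by-one {v} []        post []           1≤v 1≤post = lower 1≤v (ℕ.+-comm v 1) (lowering-refl 1≤post)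
lowering-by-one     (x ∷ pre) post (1≤x ∷ 1≤pre) 1≤v 1≤post =
  lower 1≤x (ℕ.+-identityʳ x) (lowering-by-one pre post 1≤pre 1≤v 1≤post)

lowering-by-one⁻ : ∀ {v post xs e} pre → Lowering xs (pre ++ v ∷ post) e → e ≡ 1 → v ∉ xs →
  xs ≡ pre ++ suc v ∷ post
lowering-by-one⁻ []        (lower {d = zero} _ refl _)        _    v∉ = ⊥-elim (v∉ (here (sym (ℕ.+-identityʳ _))))
lowering-by-one⁻ []        (lower {d = 1} _ refl low)         refl _  =
  cong₂ _∷_ (ℕ.+-comm _ 1) (lowering-by-zero⇒≡ low refl)
lowering-by-one⁻ (_ ∷ pre) (lower {d = zero} _ refl low)      e≡1  v∉ =
  cong₂ _∷_ (ℕ.+-identityʳ _) (lowering-by-one⁻ pre low e≡1 (v∉ ∘ there))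
lowering-by-one⁻ (_ ∷ pre) (lower {d = 1} _ refl low)         refl v∉ =
  ⊥-elim (v∉ (there (subst (_ ∈_) (sym (lowering-by-zero⇒≡ low refl)) (∈-++⁺ʳ pre (here refl)))))
lowering-by-one⁻ []        (lower {d = suc (suc _)} _ refl _) ()   _
lowering-by-one⁻ (_ ∷ _)   (lower {d = suc (suc _)} _ refl _) ()   _

∈-ΔTail⇒lowering : ∀ {xs c ks e} → (c , ks , e , []) ∈ ΔTail xs → Lowering xs ks e
∈-ΔTail⇒lowering {[]}    (here refl) = []
∈-ΔTail⇒lowering {x ∷ xs} p with find (∈-concatMap⁻ _ {xs = ΔTail xs} p)
... | (_ , _ , _ , _) , q , there r with ∈-map⁻ _ r
...   | k , k∈ , refl with ∈-map⁻ suc k∈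
...     | k′ , k′∈ , refl =
  lower (s≤s z≤n) (m+[n∸m]≡n (∈-upTo⁻ k′∈)) (∈-ΔTail⇒lowering q)

lowering⇒∈-ΔTail : ∀ {xs ks e} → Lowering xs ks e → ∃ λ c → 0 < c × (c , ks , e , []) ∈ ΔTail xs
lowering⇒∈-ΔTail []                                                 = 1 , s≤s z≤n , here refl
lowering⇒∈-ΔTail (lower {k = suc k} {d} {xs} {ks} {e} _ refl low) with lowering⇒∈-ΔTail low
... | c , c>0 , q = b * c , *-mono-≤ (k≤n⇒nCk>0 (m≤m+n (suc k) d)) c>0 , lowered
  where
  b : ℕ
  b = (suc k + d) C suc k
  lowered : (b * c , suc k ∷ ks , d + e , []) ∈ ΔTail (suc k + d ∷ xs)
  lowered = subst (λ s → (b * c , suc k ∷ ks , s + e , []) ∈ ΔTail (suc k + d ∷ xs)) (m+n∸m≡n (suc k) d)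
              (∈-concatMap⁺ _ {xs = ΔTail xs} (lose q (there (∈-map⁺ _ (∈-map⁺ suc (∈-upTo⁺ (s≤s (m≤m+n k d))))))))

∈-ΔTerms⇒lowering : ∀ {xs n ks e} → (n , 0 ∷ ks , e ∷ []) ∈ ΔTerms (0 ∷ xs) → Lowering xs ks e
∈-ΔTerms⇒lowering p with ∈-map⁻ _ (subst (_ ∈_) (++-identityʳ _) p)
... | (_ , _ , _ , []) , q , refl = ∈-ΔTail⇒lowering q

lowering⇒∈-ΔTerms : ∀ {xs ks e} → Lowering xs ks e → ∃ λ n → 0 < n × (n , 0 ∷ ks , e ∷ []) ∈ ΔTerms (0 ∷ xs)
lowering⇒∈-ΔTerms low with lowering⇒∈-ΔTail low
... | c , c>0 , q = c + 0 , subst (0 <_) (sym (ℕ.+-identityʳ c)) c>0 , ∈-++⁺ˡ (∈-map⁺ _ q)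

∈-insertions⇒↭ : ∀ {x ys zs} → zs ∈ insertions x ys → zs ↭ x ∷ ys
∈-insertions⇒↭ {ys = []}     (here refl) = ↭-refl
∈-insertions⇒↭ {ys = _ ∷ _}  (here refl) = ↭-refl
∈-insertions⇒↭ {x} {y ∷ ys} (there p) with ∈-map⁻ (y ∷_) p
... | _ , q , refl = ↭-trans (prep y (∈-insertions⇒↭ q)) (swap y x ↭-refl)

∈-permutations⇒↭ : ∀ {xs ys} → ys ∈ permutations xs → ys ↭ xs
∈-permutations⇒↭ {[]}     (here refl) = ↭-refl
∈-permutations⇒↭ {x ∷ xs} p with find (∈-concatMap⁻ (insertions x) {xs = permutations xs} p)
... | _ , q , r = ↭-trans (∈-insertions⇒↭ r) (prep x (∈-permutations⇒↭ q))

∈-Lβ⁻ : ∀ {k} (α β : Fin k → ℕ) {ω} → ω ∈ Lβ α β → ∃ λ xs → ω ≡ 0 ∷ xs × xs ↭ gammaList α β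
∈-Lβ⁻ α β p with ∈-map⁻ (0 ∷_) (deduplicate⁻ _≟c_ p)
... | xs , q , refl = xs , refl , ∈-permutations⇒↭ q

Lβ-unique : ∀ {k} (α β : Fin k → ℕ) → Unique (Lβ α β)
Lβ-unique α β = deduplicate-! _≟c_ _

∈-replicate⇒≡ : ∀ {A : Set} {x y : A} n → x ∈ replicate n y → x ≡ y
∈-replicate⇒≡ (suc n) (here refl) = refl
∈-replicate⇒≡ (suc n) (there p)   = ∈-replicate⇒≡ n p

∈-gammaList⁻ : ∀ {k} (α β : Fin k → ℕ) {z} → z ∈ gammaList α β → ∃ λ j → z ≡ β j
∈-gammaList⁻ {suc k} α β p with ∈-++⁻ (replicate (α Fin.zero) (β Fin.zero)) p
... | inj₁ q = Fin.zero , ∈-replicate⇒≡ (α Fin.zero) q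
... | inj₂ q with ∈-gammaList⁻ (α ∘ Fin.suc) (β ∘ Fin.suc) q
...   | j , refl = Fin.suc j , refl

∈-gammaList⁺ : ∀ {k} (α β : Fin k → ℕ) j → 1 ≤ α j → β j ∈ gammaList α β
∈-gammaList⁺ α β Fin.zero 1≤α with α Fin.zero
... | suc _ = here refl
∈-gammaList⁺ α β (Fin.suc j) 1≤α =
  ∈-++⁺ʳ (replicate (α Fin.zero) (β Fin.zero)) (∈-gammaList⁺ (α ∘ Fin.suc) (β ∘ Fin.suc) j 1≤α)

StrictlyIncreasing : ∀ {k} → (Fin k → ℕ) → Set
StrictlyIncreasing β = ∀ i j → i Fin.< j → β i < β j

prevβ-bound : ∀ {k} {β : Fin k → ℕ} → StrictlyIncreasing β → ∀ {i j} → j Fin.< i → β j ≤ prevβ β i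
prevβ-bound {β = β} β↑ {Fin.suc i} {j} j<i with <-cmp j (Fin.inject₁ i)
... | tri< j<i′ _ _ = <⇒≤ (β↑ j (Fin.inject₁ i) j<i′)
... | tri≈ _ refl _ = ≤-refl
... | tri> _ _ j>i′ = ⊥-elim (1+n≰n (≤-trans (subst (_< Fin.toℕ j) (toℕ-inject₁ i) j>i′) (s≤s⁻¹ j<i)))

skipped-value : ∀ {k} {β : Fin k → ℕ} → StrictlyIncreasing β → ∀ {i} → prevβ β i + 2 ≤ β i →
  ∃ λ v → suc v ≡ β i × 1 ≤ v × (∀ j → β j ≢ v)
skipped-value {β = β} β↑ {i} gap = β i ∸ 1 , 1+v≡βi , m+n≤o⇒m≤o∸n 1 2≤βi , βj≢v
  where
  2≤βi : 2 ≤ β i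
  2≤βi = m+n≤o⇒n≤o (prevβ β i) gap
  1+v≡βi : suc (β i ∸ 1) ≡ β i
  1+v≡βi = m+[n∸m]≡n (≤-trans (s≤s z≤n) 2≤βi)
  βj≢v : ∀ j → β j ≢ β i ∸ 1
  βj≢v j with <-cmp j i
  ... | tri< j<i _ _ = <⇒≢ (m+n≤o⇒m≤o∸n (suc (β j)) (subst (_≤ β i) (+-suc (β j) 1)
                                                   (≤-trans (+-monoˡ-≤ 2 (prevβ-bound β↑ j<i)) gap)))
  ... | tri≈ _ refl _ = λ βi≡v → 1+n≢n (trans 1+v≡βi βi≡v)
  ... | tri> _ _ i<j = >⇒≢ (≤-trans (≤-reflexive 1+v≡βi) (<⇒≤ (β↑ i j i<j)))

∈⇒≤sum : ∀ {n ns} → n ∈ ns → n ≤ sum ns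
∈⇒≤sum {ns = m ∷ ms} (here refl) = m≤m+n m (sum ms)
∈⇒≤sum {ns = m ∷ ms} (there p)   = ≤-trans (∈⇒≤sum p) (m≤n+m (sum ms) m)

δℕ : Comp → Comp → ℕ
δℕ x y with x ≟c y
... | yes _ = 1
... | no  _ = 0

δℕ-refl : ∀ x → δℕ x x ≡ 1
δℕ-refl x with x ≟c x
... | yes _   = refl
... | no  x≢x = ⊥-elim (x≢x refl)

Δcount : Comp → Comp → Comp → ℕ
Δcount ω ω₁ ω₂ = sum (map (λ { (n , l , r) → n * δℕ l ω₁ * δℕ r ω₂ }) (ΔTerms ω))

∈-ΔTerms⇒≤Δcount : ∀ {n ω ω₁ ω₂} → (n , ω₁ , ω₂) ∈ ΔTerms ω → n ≤ Δcount ω ω₁ ω₂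
∈-ΔTerms⇒≤Δcount {n} {ω} {ω₁} {ω₂} p = ≤-trans (≤-reflexive (sym n*1*1≡n)) (∈⇒≤sum (∈-map⁺ _ p))
  where
  n*1*1≡n : n * δℕ ω₁ ω₁ * δℕ ω₂ ω₂ ≡ n
  n*1*1≡n rewrite δℕ-refl ω₁ | δℕ-refl ω₂ | ℕ.*-identityʳ n = ℕ.*-identityʳ n

module _ {c ℓ} (K : Field c ℓ) where
  open Field K
    renaming (_+_ to _+ᴷ_; _*_ to _*ᴷ_; refl to ≈-refl; sym to ≈-sym; trans to ≈-trans; reflexive to ≈-reflexive)
  open LinComb K
  open import Algebra.Properties.Semiring.Mult semiring using (×-homo-+; ×1-homo-*) renaming (_×_ to _·_)
  open import Relation.Binary.Reasoning.Setoid setoid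

  ι≡·1# : ∀ n → ι K n ≡ n · 1#
  ι≡·1# zero    = refl
  ι≡·1# (suc n) = cong (1# +ᴷ_) (ι≡·1# n)

  ι-homo-+ : ∀ m n → ι K (m + n) ≈ ι K m +ᴷ ι K n
  ι-homo-+ m n rewrite ι≡·1# (m + n) | ι≡·1# m | ι≡·1# n = ×-homo-+ 1# m n

  ι-homo-* : ∀ m n → ι K (m * n) ≈ ι K m *ᴷ ι K n
  ι-homo-* m n rewrite ι≡·1# (m * n) | ι≡·1# m | ι≡·1# n = ×1-homo-* m n

  ι-positive≉0 : CharZero K → ∀ {n} → 0 < n → ¬ ι K n ≈ 0#
  ι-positive≉0 charZero {suc n} _ = charZero n

  x*y≈0⇒x≈0 : ∀ {x y} → ¬ y ≈ 0# → x *ᴷ y ≈ 0# → x ≈ 0#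
  x*y≈0⇒x≈0 {x} {y} y≉0 xy≈0 with inverse y y≉0
  ... | y⁻¹ , yy⁻¹≈1 = begin
    x                 ≈⟨ *-identityʳ x ⟨
    x *ᴷ 1#           ≈⟨ *-congˡ yy⁻¹≈1 ⟨
    x *ᴷ (y *ᴷ y⁻¹)   ≈⟨ *-assoc x y y⁻¹ ⟨
    (x *ᴷ y) *ᴷ y⁻¹   ≈⟨ *-congʳ xy≈0 ⟩
    0# *ᴷ y⁻¹         ≈⟨ zeroˡ y⁻¹ ⟩
    0#                ∎

  ∑ : ∀ {a} {A : Set a} → List A → (A → Carrier) → Carrier
  ∑ xs f = foldr (λ x acc → f x +ᴷ acc) 0# xs

  module _ {a} {A : Set a} where

    ∑-map : ∀ {b} {B : Set b} (g : B → A) xs f → ∑ (map g xs) f ≡ ∑ xs (f ∘ g)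
    ∑-map g []       f = refl
    ∑-map g (x ∷ xs) f = cong (f (g x) +ᴷ_) (∑-map g xs f)

    ∑-cong : ∀ (xs : List A) {f g} → (∀ x → f x ≈ g x) → ∑ xs f ≈ ∑ xs g
    ∑-cong []       f≈g = ≈-refl
    ∑-cong (x ∷ xs) f≈g = +-cong (f≈g x) (∑-cong xs f≈g)

    ∑-zero : ∀ (xs : List A) {f} → (∀ x → x ∈ xs → f x ≈ 0#) → ∑ xs f ≈ 0#
    ∑-zero []       f≈0 = ≈-refl
    ∑-zero (x ∷ xs) f≈0 = ≈-trans (+-cong (f≈0 x (here refl)) (∑-zero xs (λ y → f≈0 y ∘ there))) (+-identityˡ 0#)

    ∑-unique : ∀ {xs : List A} {f x} → Unique xs → x ∈ xs → (∀ y → y ∈ xs → y ≢ x → f y ≈ 0#) → ∑ xs f ≈ f x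
    ∑-unique {_ ∷ xs} (x∉ ∷ _) (here refl) others =
      ≈-trans (+-congˡ (∑-zero xs (λ y y∈ → others y (there y∈) (λ { refl → lookup x∉ y∈ refl })))) (+-identityʳ _)
    ∑-unique {y ∷ _} (y∉ ∷ unique) (there x∈) others =
      ≈-trans (+-cong (others y (here refl) (λ { refl → lookup y∉ x∈ refl })) (∑-unique unique x∈ (λ z → others z ∘ there)))
              (+-identityˡ _)

    ∑-ι : ∀ (xs : List A) f → ∑ xs (ι K ∘ f) ≈ ι K (sum (map f xs))
    ∑-ι []       f = ≈-refl
    ∑-ι (x ∷ xs) f = ≈-trans (+-congˡ (∑-ι xs f)) (≈-sym (ι-homo-+ (f x) _))

  δ≈ι∘δℕ : ∀ x y → δ x y ≈ ι K (δℕ x y)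
  δ≈ι∘δℕ x y with x ≟c y
  ... | yes _ = ≈-sym (+-identityʳ 1#)
  ... | no  _ = ≈-refl

  δ-≢ : ∀ {x y} → x ≢ y → δ x y ≈ 0#
  δ-≢ {x} {y} x≢y with x ≟c y
  ... | yes x≡y = ⊥-elim (x≢y x≡y)
  ... | no  _   = ≈-refl

  ΔcoeffBasis≈ι∘Δcount : ∀ ω ω₁ ω₂ → ΔcoeffBasis ω ω₁ ω₂ ≈ ι K (Δcount ω ω₁ ω₂)
  ΔcoeffBasis≈ι∘Δcount ω ω₁ ω₂ = ≈-trans (∑-cong (ΔTerms ω) term≈) (∑-ι (ΔTerms ω) _)
    where
    term≈ : ∀ ((n , l , r) : ℕ × Comp × Comp) →
            ι K n *ᴷ δ l ω₁ *ᴷ δ r ω₂ ≈ ι K (n * δℕ l ω₁ * δℕ r ω₂)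
    term≈ (n , l , r) = ≈-sym (begin
      ι K (n * δℕ l ω₁ * δℕ r ω₂)               ≈⟨ ι-homo-* (n * δℕ l ω₁) _ ⟩
      ι K (n * δℕ l ω₁) *ᴷ ι K (δℕ r ω₂)         ≈⟨ *-congʳ (ι-homo-* n _) ⟩
      ι K n *ᴷ ι K (δℕ l ω₁) *ᴷ ι K (δℕ r ω₂)    ≈⟨ *-cong (*-congˡ (δ≈ι∘δℕ l ω₁)) (δ≈ι∘δℕ r ω₂) ⟨
      ι K n *ᴷ δ l ω₁ *ᴷ δ r ω₂                  ∎)

  ΔcoeffBasis≉0 : CharZero K → ∀ {n ω ω₁ ω₂} → (n , ω₁ , ω₂) ∈ ΔTerms ω → 0 < n → ¬ ΔcoeffBasis ω ω₁ ω₂ ≈ 0#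
  ΔcoeffBasis≉0 charZero {ω = ω} {ω₁} {ω₂} t∈ n>0 coeff≈0 =
    ι-positive≉0 charZero (≤-trans n>0 (∈-ΔTerms⇒≤Δcount {ω = ω} t∈))
                 (≈-trans (≈-sym (ΔcoeffBasis≈ι∘Δcount ω ω₁ ω₂)) coeff≈0)

  ΔcoeffBasis≈0 : ∀ {ω ω₁ ω₂} → (∀ n → (n , ω₁ , ω₂) ∉ ΔTerms ω) → ΔcoeffBasis ω ω₁ ω₂ ≈ 0#
  ΔcoeffBasis≈0 {ω} {ω₁} {ω₂} absent = ∑-zero (ΔTerms ω) term≈0
    where
    term≈0 : ∀ ((n , l , r) : ℕ × Comp × Comp) → (n , l , r) ∈ ΔTerms ω → ι K n *ᴷ δ l ω₁ *ᴷ δ r ω₂ ≈ 0#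
    term≈0 (n , l , r) t∈ with l ≟c ω₁ | r ≟c ω₂
    ... | yes refl | yes refl = ⊥-elim (absent n t∈)
    ... | no  _    | _        = ≈-trans (*-congʳ (zeroʳ (ι K n))) (zeroˡ _)
    ... | yes _    | no  _    = zeroʳ _

  module _ (U : List Comp) (μ : Comp → Carrier) where

    Δcoeff≡∑ : ∀ ω₁ ω₂ → Δcoeff (map (λ ω → (μ ω , ω)) U) ω₁ ω₂ ≡ ∑ U (λ ω → μ ω *ᴷ ΔcoeffBasis ω ω₁ ω₂)
    Δcoeff≡∑ ω₁ ω₂ = ∑-map _ U _

    coeff≡∑ : ∀ ω′ → coeff (map (λ ω → (μ ω , ω)) U) ω′ ≡ ∑ U (λ ω → μ ω *ᴷ δ ω ω′)
    coeff≡∑ ω′ = ∑-map _ U _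

    primitive⇒weight≈0 : Unique U → Primitive (map (λ ω → (μ ω , ω)) U) →
      ∀ {ω ω₁ ω₂} → ω ∈ U → ω₁ ≢ unitC → ω₂ ≢ unitC →
      (∀ ω′ → ω′ ∈ U → ω′ ≢ ω → ΔcoeffBasis ω′ ω₁ ω₂ ≈ 0#) → ¬ ΔcoeffBasis ω ω₁ ω₂ ≈ 0# → μ ω ≈ 0#
    primitive⇒weight≈0 unique u-primitive {ω} {ω₁} {ω₂} ω∈ ω₁≢unit ω₂≢unit others coeff≉0 =
      x*y≈0⇒x≈0 coeff≉0 (begin
        μ ω *ᴷ ΔcoeffBasis ω ω₁ ω₂                        ≈⟨ ∑-unique unique ω∈ (λ ω′ ω′∈ ω′≢ω →
                                                               ≈-trans (*-congˡ (others ω′ ω′∈ ω′≢ω)) (zeroʳ _)) ⟨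
        ∑ U (λ ω′ → μ ω′ *ᴷ ΔcoeffBasis ω′ ω₁ ω₂)          ≡⟨ Δcoeff≡∑ ω₁ ω₂ ⟨
        Δcoeff u ω₁ ω₂                                     ≈⟨ u-primitive ω₁ ω₂ ⟩
        coeff u ω₁ *ᴷ δ ω₂ unitC +ᴷ δ ω₁ unitC *ᴷ coeff u ω₂ ≈⟨ +-cong (*-congˡ (δ-≢ ω₂≢unit)) (*-congʳ (δ-≢ ω₁≢unit)) ⟩
        coeff u ω₁ *ᴷ 0# +ᴷ 0# *ᴷ coeff u ω₂                ≈⟨ +-cong (zeroʳ _) (zeroˡ _) ⟩
        0# +ᴷ 0#                                           ≈⟨ +-identityʳ 0# ⟩
        0#                                                 ∎)
      where
      u : Elem
      u = map (λ ω′ → (μ ω′ , ω′)) U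

    weights≈0⇒IsZero : (∀ ω → ω ∈ U → μ ω ≈ 0#) → IsZero (map (λ ω → (μ ω , ω)) U)
    weights≈0⇒IsZero μ≈0 ω′ =
      ≈-trans (≈-reflexive (coeff≡∑ ω′)) (∑-zero U (λ ω ω∈ → ≈-trans (*-congʳ (μ≈0 ω ω∈)) (zeroˡ _)))

    raisable-weight≈0 : CharZero K → Unique U → Primitive (map (λ ω → (μ ω , ω)) U) → ∀ {v} → 1 ≤ v →
      (∀ {ω} → ω ∈ U → ∃ λ xs → ω ≡ 0 ∷ xs × All (1 ≤_) xs × v ∉ xs × suc v ∈ xs) →
      ∀ {ω} → ω ∈ U → μ ω ≈ 0#
    raisable-weight≈0 charZero unique u-primitive {v} 1≤v shape ω∈ with shape ω∈
    ... | xs , refl , 1≤xs , _ , 1+v∈xs with ∈-∃++ 1+v∈xs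
    ...   | pre , post , refl =
      primitive⇒weight≈0 unique u-primitive ω∈ lowered≢unit (λ ()) others lowered-coeff≉0
      where
      lowered : Comp
      lowered = 0 ∷ pre ++ v ∷ post

      lowered≢unit : lowered ≢ unitC
      lowered≢unit eq with ++-conicalʳ pre (v ∷ post) (∷-injectiveʳ eq)
      ... | ()

      lowered-coeff≉0 : ¬ ΔcoeffBasis (0 ∷ pre ++ suc v ∷ post) lowered (1 ∷ []) ≈ 0#
      lowered-coeff≉0 with ++⁻ pre 1≤xs
      ... | 1≤pre , _ ∷ 1≤post with lowering⇒∈-ΔTerms (lowering-by-one pre post 1≤pre 1≤v 1≤post)
      ...   | _ , n>0 , t∈ = ΔcoeffBasis≉0 charZero {ω = 0 ∷ pre ++ suc v ∷ post} t∈ n>0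

      others : ∀ ω′ → ω′ ∈ U → ω′ ≢ 0 ∷ pre ++ suc v ∷ post → ΔcoeffBasis ω′ lowered (1 ∷ []) ≈ 0#
      others ω′ ω′∈ ω′≢ω with shape ω′∈
      ... | xs′ , refl , _ , v∉xs′ , _ = ΔcoeffBasis≈0 {ω = 0 ∷ xs′} λ _ t∈ →
        ω′≢ω (cong (0 ∷_) (lowering-by-one⁻ pre (∈-ΔTerms⇒lowering {xs′} t∈) refl v∉xs′))

mainTheorem17 : ∀ {c ℓ} (K : Field c ℓ) → CharZero K →
    (k : ℕ) → 1 ≤ k →
    (α : Fin k → ℕ) → (∀ j → 1 ≤ α j) →
    (β : Fin k → ℕ) → (∀ j → 1 ≤ β j) → (∀ i j → i Fin.< j → β i < β j) →
    (μ : Comp → Field.Carrier K) →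
    LinComb.Primitive K (map (λ ω → (μ ω , ω)) (Lβ α β)) →
    (∃ λ i → prevβ β i + 2 ≤ β i) →
    LinComb.IsZero K (map (λ ω → (μ ω , ω)) (Lβ α β))
mainTheorem17 K charZero k _ α α≥1 β β≥1 β↑ μ u-primitive (i , gap) with skipped-value β↑ gap
... | v , 1+v≡βi , 1≤v , v∉β =
  weights≈0⇒IsZero K (Lβ α β) μ λ _ → raisable-weight≈0 K (Lβ α β) μ charZero (Lβ-unique α β) u-primitive 1≤v shape
  where
  shape : ∀ {ω} → ω ∈ Lβ α β → ∃ λ xs → ω ≡ 0 ∷ xs × All (1 ≤_) xs × v ∉ xs × suc v ∈ xs
  shape ω∈ with ∈-Lβ⁻ α β ω∈
  ... | xs , refl , xs↭γ =
    xs , refl , tabulate part≥1 , part≢v ,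
    subst (_∈ xs) (sym 1+v≡βi) (∈-resp-↭ (↭-sym xs↭γ) (∈-gammaList⁺ α β i (α≥1 i)))
    where
    part≥1 : ∀ {z} → z ∈ xs → 1 ≤ z
    part≥1 z∈ with ∈-gammaList⁻ α β (∈-resp-↭ xs↭γ z∈)
    ... | j , refl = β≥1 j
    part≢v : v ∉ xs
    part≢v v∈ with ∈-gammaList⁻ α β (∈-resp-↭ xs↭γ v∈)
    ... | j , v≡βj = v∉β j (sym v≡βj)
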